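{- Let $F$ be a $k$-graph. For all $\xi,\zeta>0$ and $c,m\in\mathbb N$ there is $n_0$ such that for all $n\geq n_0$ the following holds. Let $H$ be an $n$-vertex $k$-graph and suppose there is $\mathcal B\subseteq[m]^{(k-1)}$ such that for every $S\subseteq V(H)$ with $|S|\geq c$ there exist $v\in S$, a set $S'\subseteq S$ with $|S'|\geq\xi|S|$, and a set $\mathcal L$ with $|\mathcal L|\geq\zeta n^m$ such that $(v,m,\mathcal L,\mathcal B)$ is an $S'$-nice picture for $F$. Then $H$ contains a copy of $F$.
   Context: A $k$-graph $H=(V,E)$ has edge set consisting of $k$-subsets of $V$; $[m]^{(k-1)}$ denotes the set of $(k-1)$-subsets of $[m]=\{1,\dots,m\}$. A picture in $H$ is a tuple $(v,m,\mathcal L,\mathcal B)$ with $v\in V$, $m\in\mathbb N$, $\mathcal L\subseteq(V\setminus\{v\})^m$ a collection of $m$-tuples, and $\mathcal B\subseteq[m]^{(k-1)}$, such that for every $(x_1,\dots,x_m)\in\mathcal L$ and every $\{i_1,\dots,i_{k-1}\}\in\mathcal B$, the set $\{v,x_{i_1},\dots,x_{i_{k-1}}\}$ is an edge of $H$. Given a $k$-graph $F$ and $S\subseteq V$, a picture $(v,m,\mathcal L,\mathcal B)$ is $S$-nice for $F$ if for every $w\in S$ and every $(x_1,\dots,x_m)\in\mathcal L$, the hypergraph with vertex set $V$ and edge set $E\cup\{\{w,x_{i_1},\dots,x_{i_{k-1}}\}:\{i_1,\dots,i_{k-1}\}\in\mathcal B\}$ contains a copy of $F$.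
   Formalization: The constants ξ and ζ range over the positive rationals. -}

module Defs where

open import Level using (0ℓ)
open import Data.Nat as ℕ using (ℕ; _^_)
open import Data.Integer using (+_)
open import Data.Rational as ℚ using (ℚ; _/_)
open import Data.Fin using (Fin)
open import Data.Fin.Subset using (Subset; ⁅_⁆; _∪_; ⋃; ∣_∣; _∈_; _⊆_; ⊥)
open import Data.Bool using (if_then_else_)
open import Data.List as List using (List; length)
open import Data.List.Relation.Unary.Unique.Propositional using (Unique)
open import Data.List.Membership.Propositional renaming (_∈_ to _∈ₗ_)
open import Data.Vec as Vec using (Vec; lookup)
open import Data.Product using (Σ; ∃; ∃-syntax; _×_; _,_)
open import Data.Sum using (_⊎_)
open import Function.Definitions using (Injective)
open import Relation.Binary.PropositionalEquality using (_≡_; _≢_)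

record KGraph (k n : ℕ) : Set₁ where
  field
    Edge     : Subset n → Set
    uniform  : ∀ e → Edge e → ∣ e ∣ ≡ k
open KGraph public

image : ∀ {f n} → (Fin f → Fin n) → Subset f → Subset n
image φ p = ⋃ (List.tabulate (λ x → if lookup p x then ⁅ φ x ⁆ else ⊥))

ContainsCopy : ∀ {k f n} → KGraph k f → (Subset n → Set) → Set
ContainsCopy {f = f} {n = n} F E =
  Σ (Fin f → Fin n) λ φ → Injective _≡_ _≡_ φ × (∀ e → Edge F e → E (image φ e))

HasCopy : ∀ {k f n} → KGraph k f → KGraph k n → Set
HasCopy F H = ContainsCopy F (Edge H)

attach : ∀ {n m} → Fin n → Vec (Fin n) m → Subset m → Subset n
attach w x b = ⁅ w ⁆ ∪ image (lookup x) b

-- Families 𝓑 ⊆ [m]^(k-1), given as predicates on subsets of Fin m.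
Family : ℕ → Set₁
Family m = Subset m → Set

-- 𝓛 ⊆ (V ∖ {v})^m is a set of m-tuples: a duplicate-free list, |𝓛| = length.
-- (v, m, 𝓛, 𝓑) is a picture in H.
IsPicture : ∀ {k n} → KGraph k n → Fin n → (m : ℕ) → List (Vec (Fin n) m) → Family m → Set
IsPicture H v m 𝓛 𝓑 =
  Unique 𝓛 ×
  (∀ x → x ∈ₗ 𝓛 → ∀ i → lookup x i ≢ v) ×
  (∀ x → x ∈ₗ 𝓛 → ∀ b → 𝓑 b → Edge H (attach v x b))

IsNice : ∀ {k f n} → KGraph k f → KGraph k n → Subset n →
         (m : ℕ) → List (Vec (Fin n) m) → Family m → Set
IsNice F H S m 𝓛 𝓑 =
  ∀ w → w ∈ S → ∀ x → x ∈ₗ 𝓛 →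
    ContainsCopy F (λ e → Edge H e ⊎ (∃[ b ] (𝓑 b × e ≡ attach w x b)))

⟦_⟧ : ℕ → ℚ
⟦ n ⟧ = + n / 1

{-# OPTIONS --safe #-}
module Submission where

-- Start from S = V(H) and apply the hypothesis repeatedly, each time continuing with the set S′ it
-- provides; every round contributes at least ζ n^m tuples with a picture centred at a vertex v of
-- the current S, and all tuples collected so far stay nice for the current S. If a new tuple x was
-- already collected, niceness of the old one makes F appear once the edges {v} ∪ x_b (b ∈ 𝓑) are
-- added, but these are edges of H by the new picture. Otherwise the tuples stay distinct, and since
-- |S| shrinks at most by the factor ξ per round, n ≥ n₀ allows ⌈1/ζ⌉ + 1 rounds, which would yield
-- more than n^m distinct m-tuples.

open import Defs
open import Data.Nat as ℕ using (ℕ; zero; suc; z≤n; s≤s; _≥_; _≤_; _^_; _∸_; NonZero)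
import Data.Nat.Properties as ℕ
open import Data.Nat.Coprimality as Coprimality using (1-coprimeTo)
open import Data.Integer as ℤ using (+_; +[1+_]; +≤+; _◃_)
import Data.Integer.Properties as ℤ
open import Data.Sign using (Sign)
open import Data.Rational as ℚ using (ℚ; mkℚ; Positive)
import Data.Rational.Properties as ℚ
import Data.Rational.Unnormalised as ℚᵘ
import Data.Rational.Unnormalised.Properties as ℚᵘ
open import Data.Fin as Fin using (Fin)
open import Data.Fin.Subset using (Subset; ⊤; ∣_∣; _∈_; _⊆_)
open import Data.Fin.Subset.Properties using (∣⊤∣≡n)
open import Data.Vec using (Vec; []; _∷_)
import Data.Vec.Properties as Vec
open import Data.List using (List; []; _∷_; [_]; length; map; _++_; allFin; cartesianProductWith)
import Data.List.Properties as List
open import Data.List.Membership.Propositional using (find; lose) renaming (_∈_ to _∈ₗ_)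
open import Data.List.Membership.Propositional.Properties
  using (∈-allFin; ∈-cartesianProductWith⁺; ∈-++⁻)
import Data.List.Membership.DecPropositional as DecMembership
open import Data.List.Relation.Binary.Subset.Propositional using () renaming (_⊆_ to _⊆ₗ_)
open import Data.List.Relation.Unary.Any using (here; there; _─_; any?)
import Data.List.Relation.Unary.All as All
open import Data.List.Relation.Unary.AllPairs using ([]; _∷_)
open import Data.List.Relation.Unary.Unique.Propositional using (Unique)
import Data.List.Relation.Unary.Unique.Propositional.Properties as Unique
open import Data.Product using (Σ-syntax; ∃-syntax; _×_; _,_; proj₁)
open import Data.Sum using (_⊎_; inj₁; inj₂; [_,_]′)
open import Data.Empty using (⊥-elim)
open import Relation.Nullary using (yes; no)
open import Relation.Binary.PropositionalEquality
  using (_≡_; _≢_; refl; sym; cong; cong₂; subst; module ≡-Reasoning)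

⟦⟧≡mkℚ : ∀ s → ⟦ s ⟧ ≡ mkℚ (+ s) 0 (Coprimality.sym (1-coprimeTo s))
⟦⟧≡mkℚ s = ℚ.normalize-coprime _

positive⇒ratio-bound : ∀ ξ → Positive ξ →
  ∃[ q ] (∀ s s′ → ξ ℚ.* ⟦ s ⟧ ℚ.≤ ⟦ s′ ⟧ → s ≤ suc q ℕ.* s′)
-- ξ = (1 + a)/(1 + b) ≥ 1/(1 + b)
positive⇒ratio-bound ξ@(mkℚ +[1+ a ] b _) _ = b , bound
  where
  bound : ∀ s s′ → ξ ℚ.* ⟦ s ⟧ ℚ.≤ ⟦ s′ ⟧ → s ≤ suc b ℕ.* s′
  bound s s′ ξs≤s′ rewrite ⟦⟧≡mkℚ s | ⟦⟧≡mkℚ s′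
    with ℚᵘ.*≤* le ← ℚᵘ.≤-respˡ-≃ (ℚ.toℚᵘ-homo-* ξ (mkℚ (+ s) 0 (Coprimality.sym (1-coprimeTo s))))
                                  (ℚ.toℚᵘ-mono-≤ ξs≤s′)
    = ℤ.drop‿+≤+ (begin
      + s                                ≤⟨ +≤+ (ℕ.m≤m+n s (a ℕ.* s)) ⟩
      + (s ℕ.+ a ℕ.* s)                  ≡⟨ sym (ℤ.*-identityʳ (+ (s ℕ.+ a ℕ.* s))) ⟩
      + (s ℕ.+ a ℕ.* s) ℤ.* + 1          ≡⟨ cong (ℤ._* + 1) (ℤ.+◃n≡+n (s ℕ.+ a ℕ.* s)) ⟨
      (Sign.+ ◃ (s ℕ.+ a ℕ.* s)) ℤ.* + 1 ≤⟨ le ⟩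
      + s′ ℤ.* + suc (b ℕ.* 1)           ≡⟨ ℤ.pos-* s′ _ ⟨
      + (s′ ℕ.* suc (b ℕ.* 1))           ≡⟨ cong (λ d → + (s′ ℕ.* suc d)) (ℕ.*-identityʳ b) ⟩
      + (s′ ℕ.* suc b)                   ≡⟨ cong +_ (ℕ.*-comm s′ (suc b)) ⟩
      + (suc b ℕ.* s′)                   ∎)
    where open ℤ.≤-Reasoning

module _ {A : Set} where

  ∈-─ : ∀ {x y} {ys : List A} (x∈ys : x ∈ₗ ys) → y ∈ₗ ys → x ≢ y → y ∈ₗ (ys ─ x∈ys)
  ∈-─ (here refl) (here refl) x≢y = ⊥-elim (x≢y refl)
  ∈-─ (here _)    (there y∈)  _   = y∈
  ∈-─ (there _)   (here refl) _   = here refl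
  ∈-─ (there x∈)  (there y∈)  x≢y = there (∈-─ x∈ y∈ x≢y)

  Unique-⊆⇒length-≤ : ∀ {xs ys : List A} → Unique xs → xs ⊆ₗ ys → length xs ≤ length ys
  Unique-⊆⇒length-≤ [] _ = z≤n
  Unique-⊆⇒length-≤ {x ∷ xs} {ys} (x∉xs ∷ xs!) xs⊆ys = begin
    suc (length xs)          ≤⟨ s≤s (Unique-⊆⇒length-≤ xs! xs⊆ys─x) ⟩
    suc (length (ys ─ x∈ys)) ≡⟨ List.length-removeAt′ ys _ ⟨
    length ys                ∎
    where
    open ℕ.≤-Reasoning
    x∈ys = xs⊆ys (here refl)
    xs⊆ys─x : xs ⊆ₗ (ys ─ x∈ys)
    xs⊆ys─x z∈xs = ∈-─ x∈ys (xs⊆ys (there z∈xs)) (All.lookup x∉xs z∈xs)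

length-cartesianProductWith : ∀ {A B C : Set} (f : A → B → C) xs ys →
  length (cartesianProductWith f xs ys) ≡ length xs ℕ.* length ys
length-cartesianProductWith f []       ys = refl
length-cartesianProductWith f (x ∷ xs) ys = begin
  length (map (f x) ys ++ cartesianProductWith f xs ys)
    ≡⟨ List.length-++ (map (f x) ys) ⟩
  length (map (f x) ys) ℕ.+ length (cartesianProductWith f xs ys)
    ≡⟨ cong₂ ℕ._+_ (List.length-map (f x) ys) (length-cartesianProductWith f xs ys) ⟩
  length ys ℕ.+ length xs ℕ.* length ys
    ∎
  where open ≡-Reasoning

tuples : ∀ n m → List (Vec (Fin n) m)
tuples n zero    = [ [] ]
tuples n (suc m) = cartesianProductWith _∷_ (allFin n) (tuples n m)

length-tuples : ∀ n m → length (tuples n m) ≡ n ^ m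
length-tuples n zero    = refl
length-tuples n (suc m) = begin
  length (cartesianProductWith _∷_ (allFin n) (tuples n m))
    ≡⟨ length-cartesianProductWith _∷_ (allFin n) (tuples n m) ⟩
  length (allFin n) ℕ.* length (tuples n m)
    ≡⟨ cong₂ ℕ._*_ (List.length-tabulate {n = n} (λ i → i)) (length-tuples n m) ⟩
  n ℕ.* n ^ m
    ∎
  where open ≡-Reasoning

∈-tuples : ∀ {n m} (x : Vec (Fin n) m) → x ∈ₗ tuples n m
∈-tuples []      = here refl
∈-tuples (i ∷ x) = ∈-cartesianProductWith⁺ _∷_ (∈-allFin i) (∈-tuples x)

Unique⇒length≤n^m : ∀ {n m} {xs : List (Vec (Fin n) m)} → Unique xs → length xs ≤ n ^ m
Unique⇒length≤n^m {n} {m} xs! = begin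
  _                   ≤⟨ Unique-⊆⇒length-≤ xs! (λ {x} _ → ∈-tuples x) ⟩
  length (tuples n m) ≡⟨ length-tuples n m ⟩
  n ^ m               ∎
  where open ℕ.≤-Reasoning

Unique-overfull⇒n^m≡0 : ∀ {n m} R {xs : List (Vec (Fin n) m)} → Unique xs →
  suc R ℕ.* n ^ m ≤ R ℕ.* length xs → n ^ m ≡ 0
Unique-overfull⇒n^m≡0 {n} {m} R {xs} xs! overfull =
  ℕ.n≤0⇒n≡0 (ℕ.+-cancelʳ-≤ (R ℕ.* n ^ m) (n ^ m) 0 (begin
    n ^ m ℕ.+ R ℕ.* n ^ m ≤⟨ overfull ⟩
    R ℕ.* length xs       ≤⟨ ℕ.*-monoʳ-≤ R (Unique⇒length≤n^m xs!) ⟩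
    R ℕ.* n ^ m           ∎))
  where open ℕ.≤-Reasoning

module Niceness {k f n m} (F : KGraph k f) (H : KGraph k n) (𝓑 : Family m) where

  IsNice-antimono : ∀ {S S′ 𝓛} → S′ ⊆ S → IsNice F H S m 𝓛 𝓑 → IsNice F H S′ m 𝓛 𝓑
  IsNice-antimono S′⊆S nice w w∈S′ = nice w (S′⊆S w∈S′)

  IsNice-++ : ∀ {S 𝓛 𝓛′} → IsNice F H S m 𝓛 𝓑 → IsNice F H S m 𝓛′ 𝓑 →
              IsNice F H S m (𝓛 ++ 𝓛′) 𝓑
  IsNice-++ {𝓛 = 𝓛} nice nice′ w w∈S x x∈ = [ nice w w∈S x , nice′ w w∈S x ]′ (∈-++⁻ 𝓛 x∈)

  picture-nice⇒copy : ∀ {v S 𝓛 𝓛′ x} → IsPicture H v m 𝓛 𝓑 → IsNice F H S m 𝓛′ 𝓑 →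
                      v ∈ S → x ∈ₗ 𝓛 → x ∈ₗ 𝓛′ → HasCopy F H
  picture-nice⇒copy {v} {x = x} (_ , _ , edges) nice v∈S x∈𝓛 x∈𝓛′
    with φ , φ-injective , φ-edges ← nice v v∈S x x∈𝓛′
    = φ , φ-injective , λ e e∈F → present (φ-edges e e∈F)
    where
    present : ∀ {e} → Edge H e ⊎ ∃[ b ] (𝓑 b × e ≡ attach v x b) → Edge H e
    present (inj₁ e∈H)              = e∈H
    present (inj₂ (b , b∈𝓑 , refl)) = edges x x∈𝓛 b b∈𝓑

Pictures : ∀ {k f n} → KGraph k f → KGraph k n → (m : ℕ) → Family m →
  (Subset n → Subset n → Set) → (List (Vec (Fin n) m) → Set) → Subset n → Set
Pictures F H m 𝓑 LargeSubset LargeTupleSet S =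
  ∃[ v ] ∃[ S′ ] ∃[ 𝓛 ] (v ∈ S × S′ ⊆ S × LargeSubset S S′ × LargeTupleSet 𝓛 ×
    IsPicture H v m 𝓛 𝓑 × IsNice F H S′ m 𝓛 𝓑)

Pictures-weaken : ∀ {k f n} {F : KGraph k f} {H : KGraph k n} {c m 𝓑 A A′ B B′} →
  (∀ {S S′} → A S S′ → A′ S S′) → (∀ {𝓛} → B 𝓛 → B′ 𝓛) →
  (∀ S → c ≤ ∣ S ∣ → Pictures F H m 𝓑 A B S) → (∀ S → c ≤ ∣ S ∣ → Pictures F H m 𝓑 A′ B′ S)
Pictures-weaken A⇒A′ B⇒B′ pictures S c≤∣S∣
  with v , S′ , 𝓛 , v∈S , S′⊆S , large-S′ , large-𝓛 , picture , nice ← pictures S c≤∣S∣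
  = v , S′ , 𝓛 , v∈S , S′⊆S , A⇒A′ large-S′ , B⇒B′ large-𝓛 , picture , nice

module Iteration {k f n} (F : KGraph k f) (H : KGraph k n) (c m : ℕ) (𝓑 : Family m)
  (Q R : ℕ) .{{_ : NonZero Q}}
  (pictures : ∀ S → c ≤ ∣ S ∣ →
    Pictures F H m 𝓑 (λ S S′ → ∣ S ∣ ≤ Q ℕ.* ∣ S′ ∣) (λ 𝓛 → n ^ m ≤ R ℕ.* length 𝓛) S)
  where

  open Niceness F H 𝓑
  open DecMembership {A = Vec (Fin n) m} (Vec.≡-dec Fin._≟_) using (_∈?_)

  Tuples : Set
  Tuples = List (Vec (Fin n) m)

  copy-or-grow : ∀ S → c ≤ ∣ S ∣ → ∀ {𝓐 : Tuples} → Unique 𝓐 → IsNice F H S m 𝓐 𝓑 →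
         HasCopy F H ⊎ ∃[ S′ ] ∃[ 𝓛 ] (∣ S ∣ ≤ Q ℕ.* ∣ S′ ∣ × n ^ m ≤ R ℕ.* length 𝓛 ×
                                        Unique (𝓛 ++ 𝓐) × IsNice F H S′ m (𝓛 ++ 𝓐) 𝓑)
  copy-or-grow S c≤∣S∣ {𝓐} 𝓐! 𝓐-nice
    with v , S′ , 𝓛 , v∈S , S′⊆S , ∣S∣≤Q∣S′∣ , n^m≤R∣𝓛∣ , picture , 𝓛-nice ← pictures S c≤∣S∣
    with any? (_∈? 𝓐) 𝓛
  ... | yes shared = let x , x∈𝓛 , x∈𝓐 = find shared in
    inj₁ (picture-nice⇒copy picture 𝓐-nice v∈S x∈𝓛 x∈𝓐)
  ... | no disjoint = inj₂ (S′ , 𝓛 , ∣S∣≤Q∣S′∣ , n^m≤R∣𝓛∣ ,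
    Unique.++⁺ (proj₁ picture) 𝓐! (λ (x∈𝓛 , x∈𝓐) → disjoint (lose x∈𝓛 x∈𝓐)) ,
    IsNice-++ 𝓛-nice (IsNice-antimono S′⊆S 𝓐-nice))

  suc-c≤ : ∀ t → suc c ≤ Q ^ t ℕ.* suc c
  suc-c≤ t = ℕ.m≤n*m (suc c) (Q ^ t) {{ℕ.m^n≢0 Q t}}

  -- suc c rather than c, so that the initial bound also forces n ≢ 0.
  copy-or-accumulate : ∀ t S → Q ^ t ℕ.* suc c ≤ ∣ S ∣ → ∀ {𝓐 : Tuples} → Unique 𝓐 → IsNice F H S m 𝓐 𝓑 →
               HasCopy F H ⊎ Σ[ 𝓛 ∈ Tuples ] (Unique 𝓛 × t ℕ.* n ^ m ℕ.+ R ℕ.* length 𝓐 ≤ R ℕ.* length 𝓛)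
  copy-or-accumulate zero S _ {𝓐} 𝓐! _ = inj₂ (𝓐 , 𝓐! , ℕ.≤-refl)
  copy-or-accumulate (suc t) S bound {𝓐} 𝓐! 𝓐-nice
    with copy-or-grow S (ℕ.≤-trans (ℕ.n≤1+n c) (ℕ.≤-trans (suc-c≤ (suc t)) bound)) 𝓐! 𝓐-nice
  ... | inj₁ copy = inj₁ copy
  ... | inj₂ (S′ , 𝓛 , ∣S∣≤Q∣S′∣ , n^m≤R∣𝓛∣ , 𝓛𝓐! , 𝓛𝓐-nice)
    with copy-or-accumulate t S′ bound′ 𝓛𝓐! 𝓛𝓐-nice
    where
    bound′ : Q ^ t ℕ.* suc c ≤ ∣ S′ ∣
    bound′ = ℕ.*-cancelˡ-≤ Q (begin
      Q ℕ.* (Q ^ t ℕ.* suc c) ≡⟨ ℕ.*-assoc Q (Q ^ t) (suc c) ⟨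
      Q ^ suc t ℕ.* suc c     ≤⟨ bound ⟩
      ∣ S ∣                   ≤⟨ ∣S∣≤Q∣S′∣ ⟩
      Q ℕ.* ∣ S′ ∣            ∎)
      where open ℕ.≤-Reasoning
  ... | inj₁ copy = inj₁ copy
  ... | inj₂ (𝓛′ , 𝓛′! , counted) = inj₂ (𝓛′ , 𝓛′! , (begin
    (N ℕ.+ t ℕ.* N) ℕ.+ R ℕ.* length 𝓐       ≤⟨ ℕ.+-monoˡ-≤ _ (ℕ.+-monoˡ-≤ _ n^m≤R∣𝓛∣) ⟩
    (R ℕ.* length 𝓛 ℕ.+ t ℕ.* N) ℕ.+ R ℕ.* length 𝓐
      ≡⟨ cong (ℕ._+ R ℕ.* length 𝓐) (ℕ.+-comm (R ℕ.* length 𝓛) (t ℕ.* N)) ⟩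
    (t ℕ.* N ℕ.+ R ℕ.* length 𝓛) ℕ.+ R ℕ.* length 𝓐
      ≡⟨ ℕ.+-assoc (t ℕ.* N) _ _ ⟩
    t ℕ.* N ℕ.+ (R ℕ.* length 𝓛 ℕ.+ R ℕ.* length 𝓐)
      ≡⟨ cong (t ℕ.* N ℕ.+_) (ℕ.*-distribˡ-+ R (length 𝓛) (length 𝓐)) ⟨
    t ℕ.* N ℕ.+ R ℕ.* (length 𝓛 ℕ.+ length 𝓐)
      ≡⟨ cong (λ l → t ℕ.* N ℕ.+ R ℕ.* l) (List.length-++ 𝓛) ⟨
    t ℕ.* N ℕ.+ R ℕ.* length (𝓛 ++ 𝓐)      ≤⟨ counted ⟩
    R ℕ.* length 𝓛′                          ∎))
    where
    N = n ^ m
    open ℕ.≤-Reasoning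

  hasCopy : Q ^ suc R ℕ.* suc c ≤ n → HasCopy F H
  hasCopy n₀≤n with copy-or-accumulate (suc R) ⊤ (subst (_ ≤_) (sym (∣⊤∣≡n n)) n₀≤n) [] (λ _ _ _ ())
  ... | inj₁ copy = copy
  ... | inj₂ (𝓛 , 𝓛! , counted) = ⊥-elim (ℕ.≢-nonZero⁻¹ (n ^ m) {{ℕ.m^n≢0 n m}}
    (Unique-overfull⇒n^m≡0 R 𝓛! (ℕ.≤-trans (ℕ.m≤m+n _ _) counted)))
    where
    instance
      n≢0 : NonZero n
      n≢0 = ℕ.>-nonZero (ℕ.≤-trans (s≤s z≤n) (ℕ.≤-trans (suc-c≤ (suc R)) n₀≤n))

lemma3p3 : ∀ {k f} (F : KGraph k f) (ξ ζ : ℚ) → Positive ξ → Positive ζ → (c m : ℕ) →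
    ∃[ n₀ ] (∀ n → n ≥ n₀ → (H : KGraph k n) →
      (∃[ 𝓑 ] ((∀ b → 𝓑 b → ∣ b ∣ ≡ k ∸ 1) ×
        (∀ (S : Subset n) → c ≤ ∣ S ∣ →
          ∃[ v ] ∃[ S′ ] ∃[ 𝓛 ] (v ∈ S × S′ ⊆ S ×
            (ξ ℚ.* ⟦ ∣ S ∣ ⟧) ℚ.≤ ⟦ ∣ S′ ∣ ⟧ ×
            (ζ ℚ.* ⟦ n ^ m ⟧) ℚ.≤ ⟦ length 𝓛 ⟧ ×
            IsPicture H v m 𝓛 𝓑 × IsNice F H S′ m 𝓛 𝓑)))) →
      HasCopy F H)
lemma3p3 F ξ ζ ξ>0 ζ>0 c m
  with q , ξ-bound ← positive⇒ratio-bound ξ ξ>0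
     | r , ζ-bound ← positive⇒ratio-bound ζ ζ>0
  = suc q ^ suc (suc r) ℕ.* suc c , λ n n₀≤n H (𝓑 , _ , pictures) →
    Iteration.hasCopy F H c m 𝓑 (suc q) (suc r)
      (Pictures-weaken {F = F} {H = H} (λ {S} {S′} → ξ-bound ∣ S ∣ ∣ S′ ∣)
                                       (λ {𝓛} → ζ-bound (n ^ m) (length 𝓛)) pictures)
      n₀≤n
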